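{- Let $F$ be a number field, $p$ a prime, $\alpha\in\mathbb Q_p$, $\sigma\in G_F$, and put $\rho=\alpha(\chi_p(\sigma)-1)$. For $s\ge1$ set $J_s=-\frac1s\{B_s(-\rho)-B_s\,\chi_p(\sigma)^s\}$. Then for every positive integer $k$, $$\frac1k B_k(\alpha)\left(\chi_p(\sigma)^k-1\right)=\sum_{i=0}^{k-1}\binom{k-1}{i}\alpha^i\chi_p(\sigma)^i J_{k-i}.$$
   Context: $\chi_p:G_F\to\mathbb Z_p^\times$ is the $p$-adic cyclotomic character. Bernoulli polynomials are defined by $\sum_{k\ge0}B_k(T)\frac{w^k}{k!}=\frac{we^{Tw}}{e^w-1}$ and $B_k=B_k(0)$. -}

module Defs where

open import Level using (Level; _⊔_)
open import Data.Nat as ℕ using (ℕ; zero; suc)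
open import Data.Nat.Combinatorics using (_C_)
open import Data.List using (List; []; _∷_; lookup; length; _++_; [_])
open import Data.Rational as ℚ using (ℚ; 0ℚ; 1ℚ)
import Data.Rational.Properties as ℚP
open import Algebra.Bundles using (CommutativeRing)
open import Algebra.Morphism.Structures using (IsRingHomomorphism)

-- A ℚ-algebra: a commutative ring R together with a unital ring homomorphism ℚ → R.
-- (ℚ_p, and every field of characteristic 0, is one.)
record ℚAlgebra (c ℓ : Level) : Set (Level.suc (c ⊔ ℓ)) where
  field
    commRing : CommutativeRing c ℓ
  open CommutativeRing commRing public
  field
    ι      : ℚ → Carrier
    ι-homo : IsRingHomomorphism (CommutativeRing.rawRing ℚP.+-*-commutativeRing) rawRing ι

Σℚ : ℕ → (ℕ → ℚ) → ℚ
Σℚ zero    f = 0ℚ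
Σℚ (suc n) f = Σℚ n f ℚ.+ f n

ℕ→ℚ : ℕ → ℚ
ℕ→ℚ n = ℚ._/_ (Data.Integer.+_ n) 1
  where import Data.Integer

-- Bernoulli numbers B_0 = 1, B_n = -(1/(n+1)) Σ_{j<n} C(n+1,j) B_j  (n ≥ 1);
-- these are the B_k = B_k(0) of  w e^{Tw}/(e^w - 1), in particular B_1 = -1/2.
-- bernTable n = [B_0, …, B_n]
bernTable : ℕ → List ℚ
bernTable zero = 1ℚ ∷ []
bernTable (suc n) = prev ++ [ next ]
  where
    prev : List ℚ
    prev = bernTable n
    get : ℕ → ℚ
    get j = look prev j
      where
        look : List ℚ → ℕ → ℚ
        look []       _       = 0ℚ
        look (x ∷ xs) zero    = x
        look (x ∷ xs) (suc j) = look xs j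
    next : ℚ
    next = ℚ.- (ℚ._/_ (Data.Integer.+_ 1) (suc (suc n))
                 ℚ.* Σℚ (suc n) (λ j → ℕ→ℚ (suc (suc n) C j) ℚ.* get j))
      where import Data.Integer

bernoulli : ℕ → ℚ
bernoulli n = look (bernTable n) n
  where
    look : List ℚ → ℕ → ℚ
    look []       _       = 0ℚ
    look (x ∷ xs) zero    = x
    look (x ∷ xs) (suc j) = look xs j

module _ {c ℓ : Level} (A : ℚAlgebra c ℓ) where
  open ℚAlgebra A

  pow : Carrier → ℕ → Carrier
  pow x zero    = 1#
  pow x (suc n) = pow x n * x

  ΣA : ℕ → (ℕ → Carrier) → Carrier
  ΣA zero    f = 0#
  ΣA (suc n) f = ΣA n f + f n

  bernPoly : ℕ → Carrier → Carrier
  bernPoly k T = ΣA (suc k) (λ j → ι (ℕ→ℚ (k C j) ℚ.* bernoulli j) * pow T (k ℕ.∸ j))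

  inv : (s : ℕ) → Carrier
  inv zero    = 0#
  inv (suc s) = ι (ℚ._/_ (Data.Integer.+_ 1) (suc s))
    where import Data.Integer

  J : (α χ : Carrier) → ℕ → Carrier
  J α χ s = - (inv s * (bernPoly s (- (α * (χ - 1#))) - ι (bernoulli s) * pow χ s))

{-# OPTIONS --safe #-}
module Submission where

open import Defs
open import Level using (Level)
open import Data.Nat using (ℕ; suc; _∸_)
open import Data.Nat.Combinatorics using (_C_)

-- Put h = αχ and T = -ρ = α - h. The Bernoulli polynomials form an Appell sequence, so
-- B_n(α) = B_n(T + h) and χ^n B_n(α) = Σ_j C(n,j) B_j χ^j h^{n-j} both expand by the Taylor
-- formula A_n(T + h) = Σ_i C(n,i) h^i A_{n-i}(T), into Σ_i C(n,i) h^i B_{n-i}(T) and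
-- Σ_i C(n,i) h^i B_{n-i} χ^{n-i} respectively. In the difference B_n(α)(χ^n - 1) the i = n
-- terms cancel, and the absorption identity C(n,i)/n = C(n-1,i)/(n-i) turns the i-th
-- remaining term, divided by n, into C(n-1,i) α^i χ^i J_{n-i}.

module BinomialCoefficients where
  open import Data.Nat using (zero; _+_; _*_; _≤_; z≤n; s≤s)
  open import Data.Nat.Properties
  open import Data.Nat.Combinatorics using (nC1≡n; nCk+nC[k+1]≡[n+1]C[k+1])
  open import Data.Nat.Combinatorics.Specification using (k>n⇒nCk≡0)
  open import Relation.Binary.PropositionalEquality
  open ≡-Reasoning

  [1+k]*[1+n]C[1+k]≡[1+n]*nCk : ∀ n k → suc k * (suc n C suc k) ≡ suc n * (n C k)
  [1+k]*[1+n]C[1+k]≡[1+n]*nCk zero    zero    = refl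
  [1+k]*[1+n]C[1+k]≡[1+n]*nCk zero    (suc k) =
    trans (cong (suc (suc k) *_) (k>n⇒nCk≡0 {1} {suc (suc k)} (s≤s (s≤s z≤n)))) (*-zeroʳ (suc (suc k)))
  [1+k]*[1+n]C[1+k]≡[1+n]*nCk (suc n) zero    =
    trans (+-identityʳ _) (trans (nC1≡n (suc (suc n))) (sym (*-identityʳ (suc (suc n)))))
  [1+k]*[1+n]C[1+k]≡[1+n]*nCk (suc n) (suc k) = begin
    suc (suc k) * (suc (suc n) C suc (suc k))
      ≡⟨ cong (suc (suc k) *_) (sym (nCk+nC[k+1]≡[n+1]C[k+1] (suc n) (suc k))) ⟩
    suc (suc k) * (X + suc n C suc (suc k))
      ≡⟨ *-distribˡ-+ (suc (suc k)) X _ ⟩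
    (X + suc k * X) + suc (suc k) * (suc n C suc (suc k))
      ≡⟨ cong₂ (λ u v → (X + u) + v) ([1+k]*[1+n]C[1+k]≡[1+n]*nCk n k)
                                      ([1+k]*[1+n]C[1+k]≡[1+n]*nCk n (suc k)) ⟩
    (X + suc n * (n C k)) + suc n * (n C suc k)
      ≡⟨ +-assoc X _ _ ⟩
    X + (suc n * (n C k) + suc n * (n C suc k))
      ≡⟨ cong (X +_) (sym (*-distribˡ-+ (suc n) (n C k) (n C suc k))) ⟩
    X + suc n * (n C k + n C suc k)
      ≡⟨ cong (λ t → X + suc n * t) (nCk+nC[k+1]≡[n+1]C[k+1] n k) ⟩
    X + suc n * X ∎
    where X = suc n C suc k

  -- Adding k·C(n+1,k) to either side gives (n+1)·C(n+1,k), by absorption and Pascal's rule.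
  nCk*[1+n]≡[1+n]Ck*[1+n∸k] : ∀ n k → k ≤ n → (n C k) * suc n ≡ (suc n C k) * suc (n ∸ k)
  nCk*[1+n]≡[1+n]Ck*[1+n∸k] n       zero    z≤n       = refl
  nCk*[1+n]≡[1+n]Ck*[1+n∸k] (suc n) (suc k) (s≤s k≤n) = +-cancelˡ-≡ (suc k * Y) _ _ (begin
    suc k * Y + X * suc (suc n)
      ≡⟨ cong₂ _+_ ([1+k]*[1+n]C[1+k]≡[1+n]*nCk (suc n) k) (*-comm X (suc (suc n))) ⟩
    suc (suc n) * (suc n C k) + suc (suc n) * X
      ≡⟨ sym (*-distribˡ-+ (suc (suc n)) (suc n C k) X) ⟩
    suc (suc n) * (suc n C k + X)
      ≡⟨ cong (suc (suc n) *_) (nCk+nC[k+1]≡[n+1]C[k+1] (suc n) k) ⟩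
    suc (suc n) * Y
      ≡⟨ cong (_* Y) (sym split) ⟩
    (suc k + suc (n ∸ k)) * Y
      ≡⟨ *-distribʳ-+ Y (suc k) (suc (n ∸ k)) ⟩
    suc k * Y + suc (n ∸ k) * Y
      ≡⟨ cong (suc k * Y +_) (*-comm (suc (n ∸ k)) Y) ⟩
    suc k * Y + Y * suc (n ∸ k) ∎)
    where
    X = suc n C suc k
    Y = suc (suc n) C suc k
    split : suc k + suc (n ∸ k) ≡ suc (suc n)
    split = trans (+-suc (suc k) (n ∸ k)) (cong (λ t → suc (suc t)) (m+[n∸m]≡n k≤n))

module NaturalRationals where
  open import Data.Nat using (_+_; _*_)
  import Data.Nat.Properties as ℕₚ
  open import Data.Nat.Coprimality using (1-coprimeTo) renaming (sym to coprime-sym)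
  import Data.Integer as ℤ
  open import Data.Integer using (+_)
  import Data.Integer.Properties as ℤₚ
  open import Data.Rational as ℚ using (mkℚ)
  import Data.Rational.Properties as ℚₚ
  import Data.Rational.Unnormalised as ℚᵘ
  open import Relation.Binary.PropositionalEquality

  private
    ℕ→ℚ≡mkℚ : ∀ n → ℕ→ℚ n ≡ mkℚ (+ n) 0 (coprime-sym (1-coprimeTo n))
    ℕ→ℚ≡mkℚ n = ℚₚ.↥p/↧p≡p _

    1/[1+m]≡mkℚ : ∀ m → (+ 1 ℚ./ suc m) ≡ mkℚ (+ 1) m (1-coprimeTo (suc m))
    1/[1+m]≡mkℚ m = ℚₚ.↥p/↧p≡p _

    ℕ→ℚ*1/[1+m]≡/[1+m] : ∀ a m → ℕ→ℚ a ℚ.* (+ 1 ℚ./ suc m) ≡ (+ a ℚ./ suc m)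
    ℕ→ℚ*1/[1+m]≡/[1+m] a m rewrite ℕ→ℚ≡mkℚ a | 1/[1+m]≡mkℚ m =
      ℚₚ./-cong (ℤₚ.*-identityʳ (+ a)) (ℕₚ.+-identityʳ (suc m))

  ℕ→ℚ-+ : ∀ m n → ℕ→ℚ (m + n) ≡ ℕ→ℚ m ℚ.+ ℕ→ℚ n
  ℕ→ℚ-+ m n = trans (ℚₚ./-cong numerators refl) (sym (cong₂ ℚ._+_ (ℕ→ℚ≡mkℚ m) (ℕ→ℚ≡mkℚ n)))
    where
    numerators : + (m + n) ≡ + m ℤ.* + 1 ℤ.+ + n ℤ.* + 1
    numerators = trans (ℤₚ.pos-+ m n) (sym (cong₂ ℤ._+_ (ℤₚ.*-identityʳ (+ m)) (ℤₚ.*-identityʳ (+ n))))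

  ℕ→ℚ*1/-cross : ∀ a b m n → a * suc n ≡ b * suc m →
                 ℕ→ℚ a ℚ.* (+ 1 ℚ./ suc m) ≡ ℕ→ℚ b ℚ.* (+ 1 ℚ./ suc n)
  ℕ→ℚ*1/-cross a b m n eq = trans (ℕ→ℚ*1/[1+m]≡/[1+m] a m) (trans
    (ℚₚ.fromℚᵘ-cong {ℚᵘ.mkℚᵘ (+ a) m} {ℚᵘ.mkℚᵘ (+ b) n}
      (ℚᵘ.*≡* (trans (sym (ℤₚ.pos-* a (suc n))) (trans (cong +_ eq) (ℤₚ.pos-* b (suc m))))))
    (sym (ℕ→ℚ*1/[1+m]≡/[1+m] b n)))

module Appell {c ℓ : Level} (A : ℚAlgebra c ℓ) where
  open ℚAlgebra A
  open BinomialCoefficients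
  open NaturalRationals
  open import Data.Nat using (zero; _<_; _≤_; s≤s)
  import Data.Nat as ℕ
  import Data.Nat.Properties as ℕₚ
  open import Data.Nat.Combinatorics using (nCn≡1; nCk+nC[k+1]≡[n+1]C[k+1])
  open import Function using (_∘_)
  open import Data.Nat.Combinatorics.Specification using (k>n⇒nCk≡0)
  open import Data.Maybe using (Maybe; nothing; just)
  open import Relation.Nullary using (yes; no)
  import Relation.Binary.PropositionalEquality as ≡
  open import Data.Rational.Base using (ℚ)
  import Data.Rational.Properties as ℚₚ
  open import Algebra.Morphism.Structures using (module IsRingHomomorphism)
  open import Algebra.Solver.Ring.AlmostCommutativeRing
  import Algebra.Properties.CommutativeSemigroup as CommutativeSemigroupProperties
  open import Relation.Binary.Reasoning.Setoid setoid

  private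
    module ι = IsRingHomomorphism ι-homo
    module +-Semigroup = CommutativeSemigroupProperties +-commutativeSemigroup
    module *-Semigroup = CommutativeSemigroupProperties *-commutativeSemigroup

    ι-morphism : ℚₚ.+-*-rawRing -Raw-AlmostCommutative⟶ fromCommutativeRing commRing
    ι-morphism = record
      { ⟦_⟧ = ι ; +-homo = ι.+-homo ; *-homo = ι.*-homo ; -‿homo = ι.-‿homo
      ; 0-homo = ι.0#-homo ; 1-homo = ι.1#-homo }

    ι-coeff≟ : (p q : ℚ) → Maybe (ι p ≈ ι q)
    ι-coeff≟ p q with p ℚₚ.≟ q
    ... | yes p≡q = just (reflexive (≡.cong ι p≡q))
    ... | no _    = nothing

  open import Algebra.Solver.Ring _ (fromCommutativeRing commRing) ι-morphism ι-coeff≟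

  infixr 8 _^_
  _^_ : Carrier → ℕ → Carrier
  x ^ n = pow A x n

  Σ : ℕ → (ℕ → Carrier) → Carrier
  Σ = ΣA A

  Σ-cong : ∀ n {f g : ℕ → Carrier} → (∀ i → i < n → f i ≈ g i) → Σ n f ≈ Σ n g
  Σ-cong zero    f≈g = refl
  Σ-cong (suc n) f≈g = +-cong (Σ-cong n (λ i i<n → f≈g i (ℕₚ.m<n⇒m<1+n i<n))) (f≈g n (ℕₚ.n<1+n n))

  Σ-distrib-+ : ∀ n f g → Σ n (λ i → f i + g i) ≈ Σ n f + Σ n g
  Σ-distrib-+ zero    f g = sym (+-identityʳ 0#)
  Σ-distrib-+ (suc n) f g = trans (+-congʳ (Σ-distrib-+ n f g)) (+-Semigroup.interchange _ _ _ _)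

  Σ-distrib-- : ∀ n f g → Σ n (λ i → f i - g i) ≈ Σ n f - Σ n g
  Σ-distrib-- zero    f g = sym (-‿inverseʳ 0#)
  Σ-distrib-- (suc n) f g = trans (+-congʳ (Σ-distrib-- n f g))
    (solve 4 (λ a b c d → (a :- b) :+ (c :- d) := (a :+ c) :- (b :+ d)) refl _ _ _ _)

  *-distribˡ-Σ : ∀ n x f → x * Σ n f ≈ Σ n (λ i → x * f i)
  *-distribˡ-Σ zero    x f = zeroʳ x
  *-distribˡ-Σ (suc n) x f = trans (distribˡ x _ _) (+-congʳ (*-distribˡ-Σ n x f))

  Σ-suc : ∀ n f → Σ (suc n) f ≈ f 0 + Σ n (λ i → f (suc i))
  Σ-suc zero    f = +-comm 0# (f 0)
  Σ-suc (suc n) f = trans (+-congʳ (Σ-suc n f)) (+-assoc _ _ _)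

  Σ-vanishing : ∀ n f → (∀ i → i < n → f i ≈ 0#) → Σ n f ≈ 0#
  Σ-vanishing n f f≈0 = trans (Σ-cong n f≈0) (Σ-zero n)
    where
    Σ-zero : ∀ n → Σ n (λ _ → 0#) ≈ 0#
    Σ-zero zero    = refl
    Σ-zero (suc n) = trans (+-identityʳ _) (Σ-zero n)

  ^-cong : ∀ n {x y} → x ≈ y → x ^ n ≈ y ^ n
  ^-cong zero    x≈y = refl
  ^-cong (suc n) x≈y = *-cong (^-cong n x≈y) x≈y

  ^-distrib-* : ∀ x y n → (x * y) ^ n ≈ x ^ n * y ^ n
  ^-distrib-* x y zero    = sym (*-identityʳ 1#)
  ^-distrib-* x y (suc n) = trans (*-congʳ (^-distrib-* x y n)) (*-Semigroup.interchange _ _ _ _)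

  ^-homo-* : ∀ x m n → x ^ (m ℕ.+ n) ≈ x ^ m * x ^ n
  ^-homo-* x zero    n = sym (*-identityˡ _)
  ^-homo-* x (suc m) n = trans (*-congʳ (^-homo-* x m n)) (*-Semigroup.xy∙z≈xz∙y _ _ _)

  binom : ℕ → ℕ → Carrier
  binom n k = ι (ℕ→ℚ (n C k))

  binom-zero : ∀ n → binom n 0 ≈ 1#
  binom-zero n = ι.1#-homo

  binom-diag : ∀ n → binom n n ≈ 1#
  binom-diag n = trans (reflexive (≡.cong (ι ∘ ℕ→ℚ) (nCn≡1 n))) ι.1#-homo

  binom-over : ∀ n → binom n (suc n) ≈ 0#
  binom-over n = trans (reflexive (≡.cong (ι ∘ ℕ→ℚ) (k>n⇒nCk≡0 {n} {suc n} (ℕₚ.n<1+n n)))) ι.0#-homo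

  binom-pascal : ∀ n k → binom (suc n) (suc k) ≈ binom n k + binom n (suc k)
  binom-pascal n k = trans
    (reflexive (≡.cong ι (≡.trans (≡.cong ℕ→ℚ (≡.sym (nCk+nC[k+1]≡[n+1]C[k+1] n k)))
                                  (ℕ→ℚ-+ (n C k) (n C suc k)))))
    (ι.+-homo _ _)

  binom*inv-absorb : ∀ n k → k ≤ n → binom n k * inv A (suc (n ∸ k)) ≈ binom (suc n) k * inv A (suc n)
  binom*inv-absorb n k k≤n = trans (sym (ι.*-homo _ _)) (trans
    (reflexive (≡.cong ι (ℕ→ℚ*1/-cross (n C k) (suc n C k) (n ∸ k) n (nCk*[1+n]≡[1+n]Ck*[1+n∸k] n k k≤n))))
    (ι.*-homo _ _))

  Σ-binom-pascal : ∀ n (u : ℕ → Carrier) →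
    Σ (suc (suc n)) (λ i → binom (suc n) i * u i)
      ≈ Σ (suc n) (λ i → binom n i * u i) + Σ (suc n) (λ i → binom n i * u (suc i))
  Σ-binom-pascal n u = begin
    Σ (suc (suc n)) (λ i → binom (suc n) i * u i)
      ≈⟨ Σ-suc (suc n) _ ⟩
    binom (suc n) 0 * u 0 + Σ (suc n) (λ i → binom (suc n) (suc i) * u (suc i))
      ≈⟨ +-cong (*-identityˡ-via (binom-zero (suc n)))
                (Σ-cong (suc n) (λ i _ → trans (*-congʳ (binom-pascal n i)) (distribʳ _ _ _))) ⟩
    u 0 + Σ (suc n) (λ i → binom n i * u (suc i) + binom n (suc i) * u (suc i))
      ≈⟨ +-congˡ (Σ-distrib-+ (suc n) _ _) ⟩
    u 0 + (Σ (suc n) (λ i → binom n i * u (suc i)) + Σ (suc n) (λ i → binom n (suc i) * u (suc i)))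
      ≈⟨ +-congˡ (+-congˡ (trans (+-congˡ (trans (*-congʳ (binom-over n)) (zeroˡ _))) (+-identityʳ _))) ⟩
    u 0 + (Σ (suc n) (λ i → binom n i * u (suc i)) + Σ n (λ i → binom n (suc i) * u (suc i)))
      ≈⟨ +-Semigroup.x∙yz≈xz∙y _ _ _ ⟩
    (u 0 + Σ n (λ i → binom n (suc i) * u (suc i))) + Σ (suc n) (λ i → binom n i * u (suc i))
      ≈⟨ +-congʳ (sym (trans (Σ-suc n _) (+-congʳ (*-identityˡ-via (binom-zero n))))) ⟩
    Σ (suc n) (λ i → binom n i * u i) + Σ (suc n) (λ i → binom n i * u (suc i)) ∎
    where
    *-identityˡ-via : ∀ {a x} → a ≈ 1# → a * x ≈ x
    *-identityˡ-via a≈1 = trans (*-congʳ a≈1) (*-identityˡ _)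

  appell : (ℕ → Carrier) → ℕ → Carrier → Carrier
  appell b n T = Σ (suc n) (λ j → binom n j * b j * T ^ (n ∸ j))

  appell-cong : ∀ b n {T T′} → T ≈ T′ → appell b n T ≈ appell b n T′
  appell-cong b n T≈T′ = Σ-cong (suc n) (λ j _ → *-congˡ (^-cong (n ∸ j) T≈T′))

  appell-zero : ∀ b T → appell b 0 T ≈ b 0
  appell-zero b T = trans (+-identityˡ _) (trans (*-identityʳ _) (trans (*-congʳ (binom-zero 0)) (*-identityˡ _)))

  appell-suc : ∀ b n T → appell b (suc n) T ≈ T * appell b n T + appell (λ j → b (suc j)) n T
  appell-suc b n T = begin
    appell b (suc n) T
      ≈⟨ Σ-cong (suc (suc n)) (λ j _ → *-assoc _ _ _) ⟩
    Σ (suc (suc n)) (λ j → binom (suc n) j * (b j * T ^ (suc n ∸ j)))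
      ≈⟨ Σ-binom-pascal n (λ j → b j * T ^ (suc n ∸ j)) ⟩
    Σ (suc n) (λ j → binom n j * (b j * T ^ (suc n ∸ j))) + Σ (suc n) (λ j → binom n j * (b (suc j) * T ^ (n ∸ j)))
      ≈⟨ +-cong (trans (Σ-cong (suc n) lower-degree) (sym (*-distribˡ-Σ (suc n) T _)))
                (Σ-cong (suc n) (λ j _ → sym (*-assoc _ _ _))) ⟩
    T * appell b n T + appell (λ j → b (suc j)) n T ∎
    where
    lower-degree : ∀ j → j < suc n → binom n j * (b j * T ^ (suc n ∸ j)) ≈ T * (binom n j * b j * T ^ (n ∸ j))
    lower-degree j (s≤s j≤n) = trans
      (*-congˡ (*-congˡ (reflexive (≡.cong (T ^_) (ℕₚ.+-∸-assoc 1 j≤n)))))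
      (solve 4 (λ c b p t → c :* (b :* (p :* t)) := t :* (c :* b :* p)) refl _ _ _ _)

  appellTaylor : (ℕ → Carrier) → ℕ → Carrier → Carrier → Carrier
  appellTaylor b n T h = Σ (suc n) (λ i → binom n i * h ^ i * appell b (n ∸ i) T)

  appellTaylor-suc : ∀ b n T h →
    appellTaylor b (suc n) T h ≈ (T + h) * appellTaylor b n T h + appellTaylor (λ j → b (suc j)) n T h
  appellTaylor-suc b n T h = begin
    appellTaylor b (suc n) T h
      ≈⟨ Σ-cong (suc (suc n)) (λ i _ → *-assoc _ _ _) ⟩
    Σ (suc (suc n)) (λ i → binom (suc n) i * (h ^ i * appell b (suc n ∸ i) T))
      ≈⟨ Σ-binom-pascal n (λ i → h ^ i * appell b (suc n ∸ i) T) ⟩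
    Σ (suc n) (λ i → binom n i * (h ^ i * appell b (suc n ∸ i) T))
      + Σ (suc n) (λ i → binom n i * (h ^ i * h * appell b (n ∸ i) T))
      ≈⟨ +-cong (trans (Σ-cong (suc n) raise-index) (Σ-distrib-+ (suc n) _ _))
                (trans (Σ-cong (suc n) (λ i _ → pull-h _ _ _ _)) (sym (*-distribˡ-Σ (suc n) h _))) ⟩
    (Σ (suc n) (λ i → T * (binom n i * h ^ i * appell b (n ∸ i) T)) + appellTaylor (λ j → b (suc j)) n T h)
      + h * appellTaylor b n T h
      ≈⟨ +-congʳ (+-congʳ (sym (*-distribˡ-Σ (suc n) T _))) ⟩
    (T * appellTaylor b n T h + appellTaylor (λ j → b (suc j)) n T h) + h * appellTaylor b n T h
      ≈⟨ solve 4 (λ t h q q′ → (t :* q :+ q′) :+ h :* q := (t :+ h) :* q :+ q′) refl _ _ _ _ ⟩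
    (T + h) * appellTaylor b n T h + appellTaylor (λ j → b (suc j)) n T h ∎
    where
    pull-h : ∀ c p h a → c * (p * h * a) ≈ h * (c * p * a)
    pull-h = solve 4 (λ c p h a → c :* (p :* h :* a) := h :* (c :* p :* a)) refl
    raise-index : ∀ i → i < suc n → binom n i * (h ^ i * appell b (suc n ∸ i) T)
      ≈ T * (binom n i * h ^ i * appell b (n ∸ i) T) + binom n i * h ^ i * appell (λ j → b (suc j)) (n ∸ i) T
    raise-index i (s≤s i≤n) = trans
      (*-congˡ (*-congˡ (trans (reflexive (≡.cong (λ m → appell b m T) (ℕₚ.+-∸-assoc 1 i≤n)))
                               (appell-suc b (n ∸ i) T))))
      (solve 5 (λ c p t a a′ → c :* (p :* (t :* a :+ a′)) := t :* (c :* p :* a) :+ c :* p :* a′) refl _ _ _ _ _)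

  appell-+ : ∀ b n T h → appell b n (T + h) ≈ appellTaylor b n T h
  appell-+ b zero    T h = trans (appell-zero b (T + h)) (sym (trans (+-identityˡ _)
    (trans (*-cong (trans (*-identityʳ _) (binom-zero 0)) (appell-zero b T)) (*-identityˡ _))))
  appell-+ b (suc n) T h = begin
    appell b (suc n) (T + h)
      ≈⟨ appell-suc b n (T + h) ⟩
    (T + h) * appell b n (T + h) + appell (λ j → b (suc j)) n (T + h)
      ≈⟨ +-cong (*-congˡ (appell-+ b n T h)) (appell-+ (λ j → b (suc j)) n T h) ⟩
    (T + h) * appellTaylor b n T h + appellTaylor (λ j → b (suc j)) n T h
      ≈⟨ appellTaylor-suc b n T h ⟨
    appellTaylor b (suc n) T h ∎

  appell-at-0 : ∀ b n → appell b n 0# ≈ b n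
  appell-at-0 b n = trans (+-congʳ (Σ-vanishing n _ lower-terms)) (trans (+-identityˡ _) top-term)
    where
    lower-terms : ∀ j → j < n → binom n j * b j * 0# ^ (n ∸ j) ≈ 0#
    lower-terms j j<n with n ∸ j | ℕₚ.m<n⇒0<n∸m j<n
    ... | suc m | _ = trans (*-congˡ (zeroʳ _)) (zeroʳ _)
    top-term : binom n n * b n * 0# ^ (n ∸ n) ≈ b n
    top-term = trans (*-congˡ (reflexive (≡.cong (0# ^_) (ℕₚ.n∸n≡0 n))))
      (trans (*-identityʳ _) (trans (*-congʳ (binom-diag n)) (*-identityˡ _)))

  appell-scale : ∀ b n α χ → appell (λ j → b j * χ ^ j) n (α * χ) ≈ χ ^ n * appell b n α
  appell-scale b n α χ = trans (Σ-cong (suc n) collect-χ) (sym (*-distribˡ-Σ (suc n) _ _))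
    where
    collect-χ : ∀ j → j < suc n → binom n j * (b j * χ ^ j) * (α * χ) ^ (n ∸ j) ≈ χ ^ n * (binom n j * b j * α ^ (n ∸ j))
    collect-χ j (s≤s j≤n) = trans (*-congˡ (^-distrib-* α χ (n ∸ j)))
      (trans (solve 5 (λ c b x a y → c :* (b :* x) :* (a :* y) := (x :* y) :* (c :* b :* a)) refl _ _ _ _ _)
             (*-congʳ (trans (sym (^-homo-* χ j (n ∸ j))) (reflexive (≡.cong (χ ^_) (ℕₚ.m+[n∸m]≡n j≤n))))))

  appell-scaling-defect : ∀ b n α χ →
    appell b n α * (χ ^ n - 1#)
      ≈ Σ n (λ i → binom n i * (α * χ) ^ i * (b (n ∸ i) * χ ^ (n ∸ i) - appell b (n ∸ i) (- (α * (χ - 1#)))))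
  appell-scaling-defect b n α χ = begin
    appell b n α * (χ ^ n - 1#)
      ≈⟨ trans (solve 3 (λ p x e → p :* (x :- e) := x :* p :- p :* e) refl _ _ _) (+-congˡ (-‿cong (*-identityʳ _))) ⟩
    χ ^ n * appell b n α - appell b n α
      ≈⟨ +-cong (trans (sym (appell-scale b n α χ)) (appell-cong bχ n (sym (+-identityˡ h))))
                (-‿cong (appell-cong b n (sym T+h≈α))) ⟩
    appell bχ n (0# + h) - appell b n (T + h)
      ≈⟨ +-cong (appell-+ bχ n 0# h) (-‿cong (appell-+ b n T h)) ⟩
    (Σ n G + G n) - (Σ n F + F n)
      ≈⟨ +-congʳ (+-congˡ top-terms-agree) ⟩
    (Σ n G + F n) - (Σ n F + F n)
      ≈⟨ solve 3 (λ sg sf x → (sg :+ x) :- (sf :+ x) := sg :- sf) refl _ _ _ ⟩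
    Σ n G - Σ n F
      ≈⟨ Σ-distrib-- n G F ⟨
    Σ n (λ i → G i - F i)
      ≈⟨ Σ-cong n (λ i _ → trans (+-congʳ (*-congˡ (appell-at-0 bχ (n ∸ i))))
                                 (solve 4 (λ c p x y → c :* p :* x :- c :* p :* y := c :* p :* (x :- y)) refl _ _ _ _)) ⟩
    Σ n (λ i → binom n i * h ^ i * (b (n ∸ i) * χ ^ (n ∸ i) - appell b (n ∸ i) T)) ∎
    where
    h T : Carrier
    h = α * χ
    T = - (α * (χ - 1#))
    bχ : ℕ → Carrier
    bχ j = b j * χ ^ j
    F G : ℕ → Carrier
    F i = binom n i * h ^ i * appell b (n ∸ i) T
    G i = binom n i * h ^ i * appell bχ (n ∸ i) 0#
    T+h≈α : T + h ≈ α
    T+h≈α = trans (solve 3 (λ α χ e → :- (α :* (χ :- e)) :+ α :* χ := α :* e) refl α χ 1#) (*-identityʳ α)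
    appell-degree-0 : ∀ b′ T′ → appell b′ (n ∸ n) T′ ≈ b′ 0
    appell-degree-0 b′ T′ = trans (reflexive (≡.cong (λ m → appell b′ m T′) (ℕₚ.n∸n≡0 n))) (appell-zero b′ T′)
    top-terms-agree : G n ≈ F n
    top-terms-agree = *-congˡ (trans (appell-degree-0 bχ 0#) (trans (*-identityʳ _) (sym (appell-degree-0 b T))))

  B : ℕ → Carrier
  B j = ι (bernoulli j)

  bernPoly≈appell : ∀ n T → bernPoly A n T ≈ appell B n T
  bernPoly≈appell n T = Σ-cong (suc n) (λ j _ → *-congʳ (ι.*-homo _ _))

  binom*pow*J : ∀ α χ k i → i ≤ k →
    binom k i * α ^ i * χ ^ i * J A α χ (suc k ∸ i)
      ≈ inv A (suc k) * (binom (suc k) i * (α * χ) ^ i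
                          * (B (suc k ∸ i) * χ ^ (suc k ∸ i) - appell B (suc k ∸ i) (- (α * (χ - 1#)))))
  binom*pow*J α χ k i i≤k = begin
    binom k i * α ^ i * χ ^ i * - (inv A m * (bernPoly A m T - B m * χ ^ m))
      ≈⟨ solve 6 (λ c a x v p y → c :* a :* x :* :- (v :* (p :- y)) := (c :* v) :* (a :* x) :* (y :- p)) refl _ _ _ _ _ _ ⟩
    (binom k i * inv A m) * (α ^ i * χ ^ i) * (B m * χ ^ m - bernPoly A m T)
      ≈⟨ *-cong (*-cong (trans (*-congˡ (reflexive (≡.cong (inv A) m≡1+k∸i))) (binom*inv-absorb k i i≤k))
                        (sym (^-distrib-* α χ i)))
                (+-congˡ (-‿cong (bernPoly≈appell m T))) ⟩
    (binom (suc k) i * inv A (suc k)) * (α * χ) ^ i * (B m * χ ^ m - appell B m T)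
      ≈⟨ solve 4 (λ c v p d → c :* v :* p :* d := v :* (c :* p :* d)) refl _ _ _ _ ⟩
    inv A (suc k) * (binom (suc k) i * (α * χ) ^ i * (B m * χ ^ m - appell B m T)) ∎
    where
    m = suc k ∸ i
    T = - (α * (χ - 1#))
    m≡1+k∸i : m ≡.≡ suc (k ∸ i)
    m≡1+k∸i = ℕₚ.+-∸-assoc 1 i≤k

import Relation.Binary.Reasoning.Setoid as SetoidReasoning
open import Data.Nat using (s≤s)

lemma5p2 : {c ℓ : Level} (A : ℚAlgebra c ℓ) (α χ : ℚAlgebra.Carrier A) (k : ℕ) →
    let open ℚAlgebra A in
    inv A (suc k) * bernPoly A (suc k) α * (pow A χ (suc k) - 1#)
      ≈ ΣA A (suc k) (λ i → ι (ℕ→ℚ (k C i)) * pow A α i * pow A χ i * J A α χ (suc k ∸ i))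
lemma5p2 A α χ k = begin
    inv A n * bernPoly A n α * (χ ^ n - 1#)
      ≈⟨ *-assoc _ _ _ ⟩
    inv A n * (bernPoly A n α * (χ ^ n - 1#))
      ≈⟨ *-congˡ (trans (*-congʳ (bernPoly≈appell n α)) (appell-scaling-defect B n α χ)) ⟩
    inv A n * Σ n D
      ≈⟨ *-distribˡ-Σ n (inv A n) D ⟩
    Σ n (λ i → inv A n * D i)
      ≈⟨ Σ-cong n (λ { i (s≤s i≤k) → binom*pow*J α χ k i i≤k }) ⟨
    Σ n (λ i → binom k i * α ^ i * χ ^ i * J A α χ (n ∸ i)) ∎
  where
  open ℚAlgebra A
  open Appell A
  open SetoidReasoning setoid
  n = suc k
  D : ℕ → Carrier
  D i = binom n i * (α * χ) ^ i * (B (n ∸ i) * χ ^ (n ∸ i) - appell B (n ∸ i) (- (α * (χ - 1#))))
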